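{- Let $X$ be a finite nonempty set of positive integers and let $\mathcal{G}_X$ be the nim sequence of the all-but subtraction game with finite excluded subtraction set $X$. Fix an integer $k\geq 0$ and let $n=\min\{i\geq 0:\mathcal{G}_X(i)\geq k\}$. Then $\mathcal{G}_X(m)\geq k$ for every $m\geq n+\max(X)$.
   Context: For a finite set $X$ of positive integers, the all-but subtraction game with finite excluded subtraction set $X$ is the subtraction game with subtraction set $S=\{1,2,3,\dots\}\setminus X$: a position is a heap of $n\geq 0$ counters, and a move removes $s$ counters for some $s\in S$ with $s\leq n$. Its nim sequence is defined by $\mathcal{G}_X(n)=\operatorname{mex}\{\mathcal{G}_X(n-s): s\in S,\ s\leq n\}$ for $n\geq 0$, where $\operatorname{mex}$ of a set of nonnegative integers is the least nonnegative integer not in it. -}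

module Defs where

open import Data.Nat using (ℕ; zero; suc; _+_; _∸_; _≤_; _<_; _⊔_)
open import Data.Nat.Properties using (_≟_)
open import Data.List using (List; []; _∷_; length; upTo; map; filterᵇ; foldr)
open import Data.List.Membership.DecPropositional _≟_ using (_∈?_)
open import Data.Bool using (Bool; true; false; if_then_else_; not)
open import Relation.Nullary.Decidable using (⌊_⌋)

_∈ᵇ_ : ℕ → List ℕ → Bool
x ∈ᵇ xs = ⌊ x ∈? xs ⌋

-- mex: least natural number not occurring in the list.
-- Searching m, m+1, ... with fuel (length l + 1) suffices since
-- among 0..length l some value is missing.
mexFrom : ℕ → ℕ → List ℕ → ℕ
mexFrom zero     m l = m
mexFrom (suc f) m l = if m ∈ᵇ l then mexFrom f (suc m) l else m

mex : List ℕ → ℕ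
mex l = mexFrom (suc (length l)) 0 l

-- Safe lookup with default (never used out of range below).
nth : List ℕ → ℕ → ℕ
nth []       _       = 0
nth (x ∷ xs) zero    = x
nth (x ∷ xs) (suc i) = nth xs i

-- Given tab = [G(n-1), ..., G(0)] (so nth tab i = G(n-1-i) = G(n - (i+1))),
-- the options from heap n are G(n - s) for s = i+1 ∈ {1..n}, s ∉ X.
options : List ℕ → List ℕ → List ℕ
options X tab =
  map (λ i → nth tab i)
      (filterᵇ (λ i → not (suc i ∈ᵇ X)) (upTo (length tab)))

tab : List ℕ → ℕ → List ℕ
tab X zero    = []
tab X (suc n) = mex (options X (tab X n)) ∷ tab X n

G : List ℕ → ℕ → ℕ
G X n = mex (options X (tab X n))

-- max of a list (0 for the empty list; X is assumed nonempty below)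
maxL : List ℕ → ℕ
maxL = foldr _⊔_ 0

-- Any option value j < G(n) is reached from n by removing some s ≤ n.  From a
-- heap m = d + n with d ≥ max X the move removing d + s exceeds every excluded
-- value, so it is legal and reaches the same heap n − s.  Hence G(m) ≥ G(n) ≥ k.
module Submission where

open import Defs
open import Data.Nat using (ℕ; zero; suc; _+_; _∸_; _≤_; _<_; z≤n; s≤s)
open import Data.Nat.Properties
open import Data.Fin using (Fin; toℕ)
open import Data.Fin.Properties using (pigeonhole; toℕ<n)
open import Data.List using (List; []; _∷_; length; upTo; lookup)
open import Data.List.Relation.Unary.All using (All)
open import Data.List.Relation.Unary.Any using (here; there; index)
open import Data.List.Relation.Unary.Any.Properties using (lookup-index)
open import Data.List.Membership.Propositional using (_∈_; _∉_)
open import Data.List.Membership.Propositional.Properties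
  using (∈-map⁺; ∈-map⁻; ∈-upTo⁺; ∈-upTo⁻; ∈-filter⁺; ∈-filter⁻)
open import Data.List.Membership.DecPropositional _≟_ using (_∈?_)
open import Data.Bool using (T; not)
open import Data.Bool.Properties using (T?)
open import Data.Unit using (tt)
open import Data.Empty using (⊥-elim)
open import Data.Product using (∃-syntax; _×_; _,_)
open import Relation.Nullary using (yes; no; contradiction)
open import Relation.Binary.PropositionalEquality
  using (_≡_; _≢_; refl; sym; trans; cong; subst; module ≡-Reasoning)

mexFrom-complete : ∀ f m l j → m ≤ j → j < mexFrom f m l → j ∈ l
mexFrom-complete zero    m l j m≤j j<mex = contradiction m≤j (<⇒≱ j<mex)
mexFrom-complete (suc f) m l j m≤j j<mex with m ∈? l
... | no _ = contradiction m≤j (<⇒≱ j<mex)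
... | yes m∈l with m ≟ j
...   | yes refl = m∈l
...   | no m≢j   = mexFrom-complete f (suc m) l j (≤∧≢⇒< m≤j m≢j) j<mex

mex-complete : ∀ l j → j < mex l → j ∈ l
mex-complete l j = mexFrom-complete (suc (length l)) 0 l j z≤n

mexFrom-lower-bound : ∀ f m l k → (∀ j → m ≤ j → j < k → j ∈ l) →
                      k ≤ m + f → k ≤ mexFrom f m l
mexFrom-lower-bound zero    m l k below k≤m+0 = subst (k ≤_) (+-identityʳ m) k≤m+0
mexFrom-lower-bound (suc f) m l k below k≤m+1+f with m ∈? l
... | yes _ = mexFrom-lower-bound f (suc m) l k (λ j m<j → below j (<⇒≤ m<j))
                (subst (k ≤_) (+-suc m f) k≤m+1+f)
... | no m∉l with k ≤? m
...   | yes k≤m = k≤m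
...   | no k≰m  = ⊥-elim (m∉l (below m ≤-refl (≰⇒> k≰m)))

-- Pigeonhole on the positions in l of the k distinct values 0, …, k − 1.
length-≥-if-below-∈ : ∀ k l → (∀ j → j < k → j ∈ l) → k ≤ length l
length-≥-if-below-∈ k l below with k ≤? length l
... | yes k≤len = k≤len
... | no k≰len =
  let i , j , i<j , same = pigeonhole (≰⇒> k≰len) position
  in  contradiction (trans (value i) (trans (cong (lookup l) same) (sym (value j)))) (<⇒≢ i<j)
  where
  position : Fin k → Fin (length l)
  position i = index (below (toℕ i) (toℕ<n i))
  value : ∀ i → toℕ i ≡ lookup l (position i)
  value i = lookup-index (below (toℕ i) (toℕ<n i))

mex-lower-bound : ∀ l k → (∀ j → j < k → j ∈ l) → k ≤ mex l
mex-lower-bound l k below =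
  mexFrom-lower-bound (suc (length l)) 0 l k (λ j _ → below j)
    (m≤n⇒m≤1+n (length-≥-if-below-∈ k l below))

length-tab : ∀ X n → length (tab X n) ≡ n
length-tab X zero    = refl
length-tab X (suc n) = cong suc (length-tab X n)

nth-tab : ∀ X n i → i < n → nth (tab X n) i ≡ G X (n ∸ suc i)
nth-tab X (suc n) zero    _         = refl
nth-tab X (suc n) (suc i) (s≤s i<n) = nth-tab X n i i<n

∉⇒T-not-∈ᵇ : ∀ {x} X → x ∉ X → T (not (x ∈ᵇ X))
∉⇒T-not-∈ᵇ {x} X x∉X with x ∈? X
... | yes x∈X = x∉X x∈X
... | no _    = tt

options⁻ : ∀ X n j → j ∈ options X (tab X n) →
           ∃[ i ] i < n × G X (n ∸ suc i) ≡ j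
options⁻ X n j j∈ with ∈-map⁻ (nth (tab X n)) j∈
... | i , i∈ , refl with ∈-filter⁻ (λ a → T? (not (suc a ∈ᵇ X))) i∈
...   | i∈upTo , _ = i , i<n , sym (nth-tab X n i i<n)
  where i<n = subst (i <_) (length-tab X n) (∈-upTo⁻ i∈upTo)

options⁺ : ∀ X n i → i < n → suc i ∉ X → G X (n ∸ suc i) ∈ options X (tab X n)
options⁺ X n i i<n legal =
  subst (_∈ options X (tab X n)) (nth-tab X n i i<n)
    (∈-map⁺ (nth (tab X n))
      (∈-filter⁺ (λ a → T? (not (suc a ∈ᵇ X)))
        (subst (λ len → i ∈ upTo len) (sym (length-tab X n)) (∈-upTo⁺ i<n))
        (∉⇒T-not-∈ᵇ X legal)))

G-≤-G-shift : ∀ X d → (∀ s → d < s → s ∉ X) → ∀ n → G X n ≤ G X (d + n)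
G-≤-G-shift X d allowed n = mex-lower-bound (options X (tab X (d + n))) (G X n) reached
  where
  reached : ∀ j → j < G X n → j ∈ options X (tab X (d + n))
  reached j j<Gn with options⁻ X n j (mex-complete (options X (tab X n)) j j<Gn)
  ... | i , i<n , refl = subst (_∈ options X (tab X (d + n))) same-heap
        (options⁺ X (d + n) (d + i) (+-monoʳ-< d i<n)
          (allowed (suc (d + i)) (s≤s (m≤m+n d i))))
    where
    open ≡-Reasoning
    same-heap : G X (d + n ∸ suc (d + i)) ≡ G X (n ∸ suc i)
    same-heap = cong (G X) (begin
      d + n ∸ suc (d + i) ≡⟨ cong (d + n ∸_) (sym (+-suc d i)) ⟩
      d + n ∸ (d + suc i) ≡⟨ [m+n]∸[m+o]≡n∸o d n (suc i) ⟩
      n ∸ suc i           ∎)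

≤-maxL : ∀ X {x} → x ∈ X → x ≤ maxL X
≤-maxL (a ∷ X) (here refl) = m≤m⊔n a (maxL X)
≤-maxL (a ∷ X) (there x∈X) = ≤-trans (≤-maxL X x∈X) (m≤n⊔m a (maxL X))

maxL<⇒∉ : ∀ X s → maxL X < s → s ∉ X
maxL<⇒∉ X s maxL<s s∈X = <⇒≱ maxL<s (≤-maxL X s∈X)

mainTheorem3 : (X : List ℕ) → X ≢ [] → All (λ x → 1 ≤ x) X →
    (k n : ℕ) → k ≤ G X n → (∀ i → i < n → G X i < k) →
    ∀ m → n + maxL X ≤ m → k ≤ G X m
mainTheorem3 X _ _ k n k≤Gn _ m n+maxL≤m =
  ≤-trans k≤Gn (subst (λ h → G X n ≤ G X h) (m∸n+n≡m n≤m)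
    (G-≤-G-shift X (m ∸ n) (λ s d<s → maxL<⇒∉ X s (≤-<-trans maxL≤d d<s)) n))
  where
  n≤m : n ≤ m
  n≤m = ≤-trans (m≤m+n n (maxL X)) n+maxL≤m
  maxL≤d : maxL X ≤ m ∸ n
  maxL≤d = subst (_≤ m ∸ n) (m+n∸m≡n n (maxL X)) (∸-monoˡ-≤ n n+maxL≤m)
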